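{- Let $w\in\{a,b,\alpha,\beta\}^*$. Then $w=N(w)$ if and only if $w$ contains neither $\alpha a^k\beta$ nor $a\alpha^k b$ as a factor, for any $k\in\mathbb N$. In particular, if $w\in\{a,b,\alpha,\beta\}^*\setminus\{a,\alpha\}^*$, then $N(w)$ has a prefix of the form $a^i\beta$ or $\alpha^i b$ for some $i\in\mathbb N$.
   Context: Consider words over the four-letter alphabet $\{a,b,\alpha,\beta\}$ ($a,b$ are called Latin and $\alpha,\beta$ Greek letters) with the rewriting rules $\alpha a^k\beta = \beta b^k\alpha$ and $a\alpha^k b=b\beta^k a$ for every $k\in\mathbb N=\{0,1,2,\dots\}$ (applicable in either direction to factors). These rules preserve which positions carry Latin and which carry Greek letters. Order the letters by $a<b$ and $\alpha<\beta$. For $w\in\{a,b,\alpha,\beta\}^*$, $N(w)$ denotes the lexicographically greatest word obtainable from $w$ by finitely many applications of the rewriting rules (it is called the normalized name of $w$). -}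

module Defs where

open import Data.Nat using (ℕ)
open import Data.List using (List; []; _∷_; _++_; replicate)
open import Data.List.Relation.Unary.All using (All)
open import Data.Product using (Σ; ∃; _×_; _,_)
open import Data.Sum using (_⊎_)
open import Relation.Binary.PropositionalEquality using (_≡_)
open import Relation.Binary.Construct.Closure.ReflexiveTransitive using (Star)

data Letter : Set where
  a b α β : Letter

Word : Set
Word = List Letter

-- Letter order: a < b and α < β (Latin and Greek letters are never
-- compared, since the rewriting rules preserve Latin/Greek positions).
data _<L_ : Letter → Letter → Set where
  a<b : a <L b
  α<β : α <L β

data _<Lex_ (u v : Word) : Set where
  lex< : ∀ (p s t : Word) (x y : Letter) → x <L y →
         u ≡ p ++ (x ∷ s) → v ≡ p ++ (y ∷ t) → u <Lex v

_≤Lex_ : Word → Word → Set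
u ≤Lex v = (u ≡ v) ⊎ (u <Lex v)

data Rule : Word → Word → Set where
  greek : ∀ k → Rule (α ∷ replicate k a ++ β ∷ []) (β ∷ replicate k b ++ α ∷ [])
  latin : ∀ k → Rule (a ∷ replicate k α ++ b ∷ []) (b ∷ replicate k β ++ a ∷ [])

data Step : Word → Word → Set where
  fwd : ∀ u v {l r} → Rule l r → Step (u ++ l ++ v) (u ++ r ++ v)
  bwd : ∀ u v {l r} → Rule l r → Step (u ++ r ++ v) (u ++ l ++ v)

_~_ : Word → Word → Set
_~_ = Star Step

-- u is the normalized name N(w) of w: u is obtainable from w and is the
-- lexicographically greatest word obtainable from w.
IsN : Word → Word → Set
IsN w u = (w ~ u) × (∀ v → w ~ v → v ≤Lex u)

Factor : Word → Word → Set
Factor f w = Σ Word λ u → Σ Word λ v → w ≡ u ++ f ++ v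

Prefix : Word → Word → Set
Prefix p w = Σ Word λ s → w ≡ p ++ s

InAα : Word → Set
InAα = All (λ x → (x ≡ a) ⊎ (x ≡ α))

module Submission where

-- Orient both rules from left to right.  Each oriented step replaces a
-- redex  α aᵏ β  or  a αᵏ b  by a word that is lexicographically larger
-- (α < β resp. a < b at the first letter), and two distinct redexes of a
-- word never overlap.  Hence the oriented one-step relation _⟶_ has the
-- diamond property; by the strip lemma, two words connected by the
-- (symmetric) rewriting relation _~_ have a common _⟶_-descendant
-- (Church–Rosser).
--
-- Consequently a word without redexes is the lexicographic maximum of its
-- class, and conversely a word with a redex is beaten by its rewrite.  For
-- the second part: every rule application creates or consumes a b or a β,
-- so words over {a, α} are alone in their class; a redex-free word that is
-- not over {a, α} starts with  aⁱ β  or  αⁱ b,  since otherwise it would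
-- begin with a redex.

open import Defs
open import Data.Nat using (ℕ; zero; suc)
open import Data.List using ([]; _∷_; _++_; replicate)
open import Data.List.Properties using (++-assoc; ++-cancelˡ; ∷-injectiveˡ; ∷-injectiveʳ)
open import Data.List.Relation.Unary.All using ([]; _∷_)
open import Data.List.Relation.Unary.All.Properties using (++⁻ˡ; ++⁻ʳ)
open import Data.Product using (Σ; _×_; _,_; proj₁; proj₂)
open import Data.Sum using (_⊎_; inj₁; inj₂)
open import Data.Empty using (⊥; ⊥-elim)
open import Relation.Nullary using (¬_)
open import Function.Bundles using (_⇔_; mk⇔)
open import Relation.Binary.PropositionalEquality using (_≡_; refl; sym; trans; cong; cong₂)
open import Relation.Binary.Construct.Closure.ReflexiveTransitive using (Star; ε; _◅_; _◅◅_)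

HasRedex : Word → Set
HasRedex w = Σ ℕ λ k → Factor (α ∷ replicate k a ++ β ∷ []) w
                     ⊎ Factor (a ∷ replicate k α ++ b ∷ []) w

redex-cons : ∀ x {w} → HasRedex w → HasRedex (x ∷ w)
redex-cons x (k , inj₁ (u , v , e)) = k , inj₁ (x ∷ u , v , cong (x ∷_) e)
redex-cons x (k , inj₂ (u , v , e)) = k , inj₂ (x ∷ u , v , cong (x ∷_) e)

-- Both rules have the shape  opening · innerᵏ · closing → closing · inner′ᵏ · opening.
data Kind : Set where
  greekKind latinKind : Kind

opening inner inner′ closing : Kind → Letter
opening greekKind = α
opening latinKind = a
inner greekKind = a
inner latinKind = α
inner′ greekKind = b
inner′ latinKind = β
closing greekKind = β
closing latinKind = b

-- Tail κ s t:  s = innerᵏ closing v  and  t = inner′ᵏ opening v  for some k, v;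
-- i.e. what follows the first letter of a redex and of its rewrite.
data Tail (κ : Kind) : Word → Word → Set where
  close : ∀ (v : Word) → Tail κ (closing κ ∷ v) (opening κ ∷ v)
  pass  : ∀ {s t : Word} → Tail κ s t → Tail κ (inner κ ∷ s) (inner′ κ ∷ t)

infix 4 _⟶_ _⟶*_

data _⟶_ : Word → Word → Set where
  greekHere : ∀ {s t : Word} → Tail greekKind s t → α ∷ s ⟶ β ∷ t
  latinHere : ∀ {s t : Word} → Tail latinKind s t → a ∷ s ⟶ b ∷ t
  there     : ∀ x {s t : Word} → s ⟶ t → x ∷ s ⟶ x ∷ t

_⟶*_ : Word → Word → Set
_⟶*_ = Star _⟶_

here : ∀ κ {s t} → Tail κ s t → opening κ ∷ s ⟶ closing κ ∷ t
here greekKind = greekHere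
here latinKind = latinHere

replicate-tail : ∀ κ k v → Tail κ ((replicate k (inner κ) ++ closing κ ∷ []) ++ v)
                                  ((replicate k (inner′ κ) ++ opening κ ∷ []) ++ v)
replicate-tail κ zero v = close v
replicate-tail κ (suc k) v = pass (replicate-tail κ k v)

tail-replicate : ∀ {κ s t} → Tail κ s t →
                 Σ ℕ λ k → Σ Word λ v → s ≡ (replicate k (inner κ) ++ closing κ ∷ []) ++ v
tail-replicate (close v) = 0 , v , refl
tail-replicate (pass g) with tail-replicate g
... | k , v , e = suc k , v , cong (_ ∷_) e

⟶-under : ∀ u {s t} → s ⟶ t → u ++ s ⟶ u ++ t
⟶-under [] f = f
⟶-under (x ∷ u) f = there x (⟶-under u f)

rule⟶ : ∀ {l r} → Rule l r → ∀ u v → u ++ l ++ v ⟶ u ++ r ++ v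
rule⟶ (greek k) u v = ⟶-under u (greekHere (replicate-tail greekKind k v))
rule⟶ (latin k) u v = ⟶-under u (latinHere (replicate-tail latinKind k v))

step-oriented : ∀ {x y} → Step x y → x ⟶ y ⊎ y ⟶ x
step-oriented (fwd u v r) = inj₁ (rule⟶ r u v)
step-oriented (bwd u v r) = inj₂ (rule⟶ r u v)

⟶-redex : ∀ {x y} → x ⟶ y → HasRedex x
⟶-redex (greekHere g) with tail-replicate g
... | k , v , e = k , inj₁ ([] , v , cong (α ∷_) e)
⟶-redex (latinHere g) with tail-replicate g
... | k , v , e = k , inj₂ ([] , v , cong (a ∷_) e)
⟶-redex (there x f) = redex-cons x (⟶-redex f)

redex-step : ∀ {w} → HasRedex w → Σ Word λ w′ → Step w w′ × w ⟶ w′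
redex-step (k , inj₁ (u , v , refl)) = _ , fwd u v (greek k) , rule⟶ (greek k) u v
redex-step (k , inj₂ (u , v , refl)) = _ , fwd u v (latin k) , rule⟶ (latin k) u v

tail-functional : ∀ {κ s t t′} → Tail κ s t → Tail κ s t′ → t ≡ t′
tail-functional {greekKind} (close v) (close .v) = refl
tail-functional {greekKind} (pass g) (pass g′) = cong (b ∷_) (tail-functional g g′)
tail-functional {latinKind} (close v) (close .v) = refl
tail-functional {latinKind} (pass g) (pass g′) = cong (β ∷_) (tail-functional g g′)

-- A Greek tail starts with a or β, a Latin tail with α or b.
tails-disjoint : ∀ {s t t′} → Tail greekKind s t → Tail latinKind s t′ → ⊥
tails-disjoint (close _) ()
tails-disjoint (pass _) ()

-- No redex starts inside a tail: a step in a tail happens after its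
-- closing letter, and it commutes with rewriting the surrounding redex.
tail-step : ∀ {κ s t s′} → Tail κ s t → s ⟶ s′ → Σ Word λ t′ → Tail κ s′ t′ × t ⟶ t′
tail-step {greekKind} (close v) (there _ f) = _ , close _ , there α f
tail-step {greekKind} (pass g) (latinHere h) = ⊥-elim (tails-disjoint g h)
tail-step {greekKind} (pass g) (there _ f) with tail-step g f
... | t′ , g′ , f′ = b ∷ t′ , pass g′ , there b f′
tail-step {latinKind} (close v) (there _ f) = _ , close _ , there a f
tail-step {latinKind} (pass g) (greekHere h) = ⊥-elim (tails-disjoint h g)
tail-step {latinKind} (pass g) (there _ f) with tail-step g f
... | t′ , g′ , f′ = β ∷ t′ , pass g′ , there β f′

Joinable : Word → Word → Set
Joinable y z = (y ≡ z) ⊎ Σ Word λ t → y ⟶ t × z ⟶ t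

swap-joinable : ∀ {y z} → Joinable y z → Joinable z y
swap-joinable (inj₁ e) = inj₁ (sym e)
swap-joinable (inj₂ (t , f , g)) = inj₂ (t , g , f)

here-there : ∀ κ {s t s′} → Tail κ s t → s ⟶ s′ →
             Joinable (closing κ ∷ t) (opening κ ∷ s′)
here-there κ g f with tail-step g f
... | t′ , g′ , f′ = inj₂ (closing κ ∷ t′ , there _ f′ , here κ g′)

diamond : ∀ {x y z} → x ⟶ y → x ⟶ z → Joinable y z
diamond (greekHere g) (greekHere g′) = inj₁ (cong (β ∷_) (tail-functional g g′))
diamond (latinHere g) (latinHere g′) = inj₁ (cong (b ∷_) (tail-functional g g′))
diamond (greekHere g) (there _ f) = here-there greekKind g f
diamond (latinHere g) (there _ f) = here-there latinKind g f
diamond (there _ f) (greekHere g) = swap-joinable (here-there greekKind g f)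
diamond (there _ f) (latinHere g) = swap-joinable (here-there latinKind g f)
diamond (there x f) (there _ g) with diamond f g
... | inj₁ e = inj₁ (cong (x ∷_) e)
... | inj₂ (t , f′ , g′) = inj₂ (x ∷ t , there x f′ , there x g′)

strip : ∀ {x y z} → x ⟶ y → x ⟶* z → Σ Word λ t → y ⟶* t × z ⟶* t
strip f ε = _ , ε , f ◅ ε
strip f (g ◅ p) with diamond f g
... | inj₁ refl = _ , p , ε
... | inj₂ (s , f′ , g′) with strip g′ p
...   | t , q , r = t , f′ ◅ q , r

-- Church–Rosser: rewriting-equivalent words have a common descendant
-- (a backward step is handled by the strip lemma).
church-rosser : ∀ {x y} → x ~ y → Σ Word λ t → x ⟶* t × y ⟶* t
church-rosser ε = _ , ε , ε
church-rosser (s ◅ rest) with church-rosser rest | step-oriented s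
... | t , p , q | inj₁ f = t , f ◅ p , q
... | t , p , q | inj₂ f with strip f p
...   | t′ , p′ , q′ = t′ , p′ , q ◅◅ q′

compare-positions : ∀ p p′ (y x′ : Letter) t s′ → p ++ y ∷ t ≡ p′ ++ x′ ∷ s′ →
    ((p ≡ p′) × (y ≡ x′)) ⊎ ((Σ Word λ r → p′ ≡ p ++ y ∷ r) ⊎ (Σ Word λ r → p ≡ p′ ++ x′ ∷ r))
compare-positions [] [] y x′ t s′ eq = inj₁ (refl , ∷-injectiveˡ eq)
compare-positions [] (z ∷ p′) y x′ t s′ eq =
  inj₂ (inj₁ (p′ , cong₂ _∷_ (sym (∷-injectiveˡ eq)) refl))
compare-positions (z ∷ p) [] y x′ t s′ eq =
  inj₂ (inj₂ (p , cong₂ _∷_ (∷-injectiveˡ eq) refl))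
compare-positions (z ∷ p) (z′ ∷ p′) y x′ t s′ eq
  with compare-positions p p′ y x′ t s′ (∷-injectiveʳ eq)
... | inj₁ (e , e′) = inj₁ (cong₂ _∷_ (∷-injectiveˡ eq) e , e′)
... | inj₂ (inj₁ (r , e)) = inj₂ (inj₁ (r , cong₂ _∷_ (sym (∷-injectiveˡ eq)) e))
... | inj₂ (inj₂ (r , e)) = inj₂ (inj₂ (r , cong₂ _∷_ (∷-injectiveˡ eq) e))

<L-no-chain : ∀ {x y z} → x <L y → y <L z → ⊥
<L-no-chain a<b ()
<L-no-chain α<β ()

-- Transitivity: the earlier of the two differing positions decides.
<Lex-trans : ∀ {u v w} → u <Lex v → v <Lex w → u <Lex w
<Lex-trans (lex< p s t x y xy refl refl) (lex< p′ s′ t′ x′ y′ xy′ e refl)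
  with compare-positions p p′ y x′ t s′ e
... | inj₁ (refl , refl) = ⊥-elim (<L-no-chain xy xy′)
... | inj₂ (inj₁ (r , refl)) = lex< p s (r ++ y′ ∷ t′) x y xy refl (++-assoc p (y ∷ r) (y′ ∷ t′))
... | inj₂ (inj₂ (r , refl)) = lex< p′ (r ++ x ∷ s) t′ x′ y′ xy′ (++-assoc p′ (x′ ∷ r) (x ∷ s)) refl

<L-irrefl : ∀ {x} → ¬ (x <L x)
<L-irrefl ()

-- Lexicographic order is a strict order: the two decompositions of u
-- mark the same position, where the letters would have to be equal.
<Lex-irrefl : ∀ {u} → ¬ (u <Lex u)
<Lex-irrefl (lex< p s t x y xy e₁ e₂)
  with ∷-injectiveˡ (++-cancelˡ p (x ∷ s) (y ∷ t) (trans (sym e₁) e₂))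
... | refl = <L-irrefl xy

-- An oriented step increases the first letter of the redex.
⟶-lex : ∀ {x y} → x ⟶ y → x <Lex y
⟶-lex (greekHere g) = lex< [] _ _ α β α<β refl refl
⟶-lex (latinHere g) = lex< [] _ _ a b a<b refl refl
⟶-lex (there x f) with ⟶-lex f
... | lex< p s t y z lt e₁ e₂ = lex< (x ∷ p) s t y z lt (cong (x ∷_) e₁) (cong (x ∷_) e₂)

⟶*-lex : ∀ {x y} → x ⟶* y → x ≤Lex y
⟶*-lex ε = inj₁ refl
⟶*-lex (f ◅ p) with ⟶*-lex p
... | inj₁ refl = inj₂ (⟶-lex f)
... | inj₂ l = inj₂ (<Lex-trans (⟶-lex f) l)

-- A redex-free word is greatest in its class: any v ~ w has a common
-- descendant with w, which must be w itself.
redex-free⇒normal : ∀ w → ¬ HasRedex w → IsN w w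
redex-free⇒normal w free = ε , λ v w~v → below (church-rosser w~v)
  where
  below : ∀ {v} → Σ Word (λ t → w ⟶* t × v ⟶* t) → v ≤Lex w
  below (t , ε , q) = ⟶*-lex q
  below (t , f ◅ _ , q) = ⊥-elim (free (⟶-redex f))

-- Rewriting a redex yields a larger word in the same class.
normal⇒redex-free : ∀ w → IsN w w → ¬ HasRedex w
normal⇒redex-free w (_ , greatest) redex with redex-step redex
... | w′ , s , f with greatest w′ (s ◅ ε)
...   | inj₁ refl = <Lex-irrefl (⟶-lex f)
...   | inj₂ w′<w = <Lex-irrefl (<Lex-trans (⟶-lex f) w′<w)

normal-idempotent : ∀ {w u} → IsN w u → IsN u u
normal-idempotent (w~u , greatest) = ε , λ v u~v → greatest v (w~u ◅◅ u~v)

b∉Aα : ∀ {s} → ¬ InAα (b ∷ s)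
b∉Aα (inj₁ () ∷ _)
b∉Aα (inj₂ () ∷ _)

β∉Aα : ∀ {s} → ¬ InAα (β ∷ s)
β∉Aα (inj₁ () ∷ _)
β∉Aα (inj₂ () ∷ _)

rule-sides-not-Aα : ∀ {l r} → Rule l r → ∀ v → ¬ InAα (l ++ v) × ¬ InAα (r ++ v)
rule-sides-not-Aα (greek k) v =
  (λ { (_ ∷ h) → β∉Aα (++⁻ʳ (replicate k a) (++⁻ˡ (replicate k a ++ β ∷ []) h)) }) , β∉Aα
rule-sides-not-Aα (latin k) v =
  (λ { (_ ∷ h) → b∉Aα (++⁻ʳ (replicate k α) (++⁻ˡ (replicate k α ++ b ∷ []) h)) }) , b∉Aα

step-not-Aα : ∀ {x y} → Step x y → ¬ InAα y
step-not-Aα (fwd u v r) h = proj₂ (rule-sides-not-Aα r v) (++⁻ʳ u h)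
step-not-Aα (bwd u v r) h = proj₁ (rule-sides-not-Aα r v) (++⁻ʳ u h)

~-Aα : ∀ {x y} → x ~ y → InAα y → InAα x
~-Aα ε h = h
~-Aα (s ◅ p) h = ⊥-elim (step-not-Aα s (~-Aα p h))

redex-free-prefix : ∀ u → ¬ InAα u → ¬ HasRedex u →
    Σ ℕ λ i → Prefix (replicate i a ++ β ∷ []) u ⊎ Prefix (replicate i α ++ b ∷ []) u
redex-free-prefix [] notAα _ = ⊥-elim (notAα [])
redex-free-prefix (b ∷ s) _ _ = 0 , inj₂ (s , refl)
redex-free-prefix (β ∷ s) _ _ = 0 , inj₁ (s , refl)
redex-free-prefix (a ∷ s) notAα free
  with redex-free-prefix s (λ h → notAα (inj₁ refl ∷ h)) (λ r → free (redex-cons a r))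
... | i , inj₁ (r , e) = suc i , inj₁ (r , cong (a ∷_) e)
... | i , inj₂ (r , e) = ⊥-elim (free (i , inj₂ ([] , r , cong (a ∷_) e)))
redex-free-prefix (α ∷ s) notAα free
  with redex-free-prefix s (λ h → notAα (inj₂ refl ∷ h)) (λ r → free (redex-cons α r))
... | i , inj₁ (r , e) = ⊥-elim (free (i , inj₁ ([] , r , cong (α ∷_) e)))
... | i , inj₂ (r , e) = suc i , inj₂ (r , cong (α ∷_) e)

mainTheorem2 : (∀ (w : Word) →
                  IsN w w ⇔
                  (¬ (Σ ℕ λ k → Factor (α ∷ replicate k a ++ β ∷ []) w
                                ⊎ Factor (a ∷ replicate k α ++ b ∷ []) w)))
               × (∀ (w u : Word) → ¬ InAα w → IsN w u →
                  Σ ℕ λ i → Prefix (replicate i a ++ β ∷ []) u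
                            ⊎ Prefix (replicate i α ++ b ∷ []) u)
mainTheorem2 = characterisation , prefix
  where
  characterisation : ∀ w → IsN w w ⇔ (¬ HasRedex w)
  characterisation w = mk⇔ (normal⇒redex-free w) (redex-free⇒normal w)

  prefix : ∀ w u → ¬ InAα w → IsN w u →
           Σ ℕ λ i → Prefix (replicate i a ++ β ∷ []) u ⊎ Prefix (replicate i α ++ b ∷ []) u
  prefix w u notAα w↦u =
    redex-free-prefix u (λ h → notAα (~-Aα (proj₁ w↦u) h))
                      (normal⇒redex-free u (normal-idempotent w↦u))
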